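{- Let $G$ be a connected graph of order $n$ and independence number $\alpha$, where $n\ge 2\alpha$. Then there exist an integer $t\le 2\alpha-1$, a subtree $\bar T$ of $G$ of order $t$, and a spanning tree $T$ of $G$ obtained from $\bar T$ by attaching the remaining $n-t$ vertices of $G$ as pendent vertices (each adjacent in $T$ to some vertex of $\bar T$), such that, when $t=2\alpha-1$: (i) if $\bar T$ is not a path, every pendent path and every internal path of $\bar T$ has even length; (ii) if $\bar T$ is a path $v_1v_2\cdots v_{2\alpha-1}$, then the $n-2\alpha+1$ pendent vertices are attached only to vertices among $v_1,v_3,\dots,v_{2\alpha-1}$.
   Context: The independence number of a graph is the maximum cardinality of a set of pairwise non-adjacent vertices. A pendent vertex is a vertex of degree 1. In a graph $H$, let $P=x_0x_1\cdots x_k$ ($k\ge1$) be a path with $d_H(x_0)\ge3$ and $d_H(x_1)=\dots=d_H(x_{k-1})=2$ (here $d_H$ denotes degree). If $d_H(x_k)\ge3$, $P$ is an internal path of $H$; if $d_H(x_k)=1$, $P$ is a pendent path of $H$. The length of a path is its number of edges. -}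

module Defs where

open import Data.Nat using (ℕ; suc; _≤_; _+_; _*_)
open import Data.Nat.Divisibility using (_∣_)
open import Data.Fin using (Fin; toℕ)
open import Data.Fin.Subset using (Subset; _∈_; _∉_; _∩_; ∣_∣)
open import Data.Vec using (tabulate)
open import Data.List using (List; []; _∷_; _++_; length; lookup)
open import Data.List.Relation.Unary.All using (All)
open import Data.List.Relation.Unary.Unique.Propositional using (Unique)
open import Data.List.Relation.Unary.Linked using (Linked)
import Data.List.Membership.Propositional as LM
open import Data.Product using (Σ; _×_; ∃; ∃-syntax)
open import Data.Sum using (_⊎_)
open import Data.Empty using (⊥)
open import Relation.Nullary using (¬_; Dec; does)
open import Relation.Binary.PropositionalEquality using (_≡_)
open import Function.Bundles using (_⇔_)

record Graph (n : ℕ) : Set₁ where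
  field
    Adj    : Fin n → Fin n → Set
    adj?   : ∀ u v → Dec (Adj u v)
    sym    : ∀ {u v} → Adj u v → Adj v u
    irrefl : ∀ {u} → ¬ Adj u u
open Graph public

module _ {n : ℕ} where

  SubgraphOf : Graph n → Graph n → Set
  SubgraphOf H G = ∀ u v → Adj H u v → Adj G u v

  data Walk (P : Fin n → Set) (E : Fin n → Fin n → Set) : Fin n → Fin n → Set where
    here : ∀ {u} → P u → Walk P E u u
    step : ∀ {u v w} → P u → E u v → Walk P E v w → Walk P E u w

  ConnectedOn : (Fin n → Set) → (Fin n → Fin n → Set) → Set
  ConnectedOn P E = (∃[ v ] P v) × (∀ u v → P u → P v → Walk P E u v)

  AcyclicOn : (Fin n → Set) → (Fin n → Fin n → Set) → Set
  AcyclicOn P E = ∀ (x : Fin n) (ys : List (Fin n)) → 2 ≤ length ys →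
    Unique (x ∷ ys) → All P (x ∷ ys) → Linked E (x ∷ ys ++ x ∷ []) → ⊥

  IsTreeOn : (Fin n → Set) → (Fin n → Fin n → Set) → Set
  IsTreeOn P E = ConnectedOn P E × AcyclicOn P E

  AllV : Fin n → Set
  AllV _ = Fin n

  Connected : Graph n → Set
  Connected G = ConnectedOn AllV (Adj G)

  SpanningTreeOf : Graph n → Graph n → Set
  SpanningTreeOf T G = SubgraphOf T G × IsTreeOn AllV (Adj T)

  -- the subgraph of T induced on S (this is T̄)
  InS : Subset n → Fin n → Set
  InS S v = v ∈ S

  Nbhd : Graph n → Fin n → Subset n
  Nbhd T v = tabulate (λ u → does (adj? T v u))

  degree : Graph n → Fin n → ℕ
  degree T v = ∣ Nbhd T v ∣

  degIn : Subset n → Graph n → Fin n → ℕ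
  degIn S T v = ∣ S ∩ Nbhd T v ∣

  IsPathIn : Subset n → Graph n → List (Fin n) → Set
  IsPathIn S T xs = Unique xs × All (InS S) xs × Linked (Adj T) xs

  IsPathListing : Subset n → Graph n → List (Fin n) → Set
  IsPathListing S T ps = IsPathIn S T ps × (∀ v → (v ∈ S) ⇔ (v LM.∈ ps))

  IsPathGraph : Subset n → Graph n → Set
  IsPathGraph S T = ∃[ ps ] IsPathListing S T ps

  -- condition (i): every pendent path and every internal path of T[S]
  -- (x0 with degree ≥ 3, interior vertices of degree 2, end of degree 1 or ≥ 3)
  -- has even length (length = number of edges = length mid + 1)
  PendentInternalPathsEven : Subset n → Graph n → Set
  PendentInternalPathsEven S T =
    ∀ (x₀ : Fin n) (mid : List (Fin n)) (xₖ : Fin n) →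
      IsPathIn S T (x₀ ∷ mid ++ xₖ ∷ []) →
      3 ≤ degIn S T x₀ →
      All (λ x → degIn S T x ≡ 2) mid →
      (3 ≤ degIn S T xₖ ⊎ degIn S T xₖ ≡ 1) →
      2 ∣ suc (length mid)

  Independent : Graph n → Subset n → Set
  Independent G I = ∀ u v → u ∈ I → v ∈ I → ¬ Adj G u v

  IsIndependenceNumber : Graph n → ℕ → Set
  IsIndependenceNumber G α =
    (∃[ I ] (Independent G I × ∣ I ∣ ≡ α)) ×
    (∀ I → Independent G I → ∣ I ∣ ≤ α)

{-# OPTIONS --safe #-}
module Submission where

-- Grow from a vertex r a tree T̄ of G together with the colour class I ∋ r of its 2-colouring,
-- keeping I independent in G and |T̄| + 1 ≤ 2|I|. While some vertex is not dominated by I, a walk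
-- to r yields an undominated x adjacent to a dominated y ∉ I. If y ∈ T̄, hang x on y and put x
-- into I; otherwise hang y on a neighbour s ∈ I of y, hang x on y, and put x into I. The second
-- move preserves |T̄| + 1 = 2|I| and gives the new vertex y ∉ I exactly one child; the first makes
-- the inequality strict for good. Once I dominates G, hang every remaining vertex on a neighbour
-- in I. Then t = |T̄| ≤ 2|I| - 1 ≤ 2α - 1, and if t = 2α - 1 every vertex of T̄ outside I has
-- degree 2 in T̄. Hence the ends of pendent and internal paths, the ends of T̄ when it is a path,
-- and all attachment points lie in I; since colours alternate along paths, the lengths in (i) and
-- the positions in (ii) are even.

open import Defs hiding (sym)
open import Data.Bool using (true; false)
open import Data.Empty using (⊥; ⊥-elim)
open import Data.Fin using (Fin; toℕ; _≟_) renaming (zero to fzero; suc to fsuc)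
open import Data.Fin.Subset using (Subset; _∈_; _∉_; _⊆_; _∪_; ⁅_⁆; ∣_∣)
open import Data.Fin.Subset.Properties
  using (_∈?_; ∈⊤; ⊆-antisym; x∈⁅x⁆; x∈⁅y⁆⇒x≡y; ∣⁅x⁆∣≡1; x∈p∪q⁺; x∈p∪q⁻; x∈p∩q⁺; x∈p∩q⁻;
         p⊆p∪q; ∪-identityʳ; ∣p∣≤n; ∣p∣≡n⇒p≡⊤)
open import Data.Fin.Properties using (any?; all?; ¬∀⟶∃¬)
open import Data.List using (List; []; _∷_; _++_; length; lookup)
open import Data.List.Membership.Propositional using () renaming (_∈_ to _∈ˡ_)
open import Data.List.Membership.Propositional.Properties using (∈-∃++)
open import Data.List.Properties using (++-assoc; length-++-≤ʳ)
open import Data.List.Relation.Unary.All as All using (All; []; _∷_)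
open import Data.List.Relation.Unary.All.Properties using (++⁻ʳ)
open import Data.List.Relation.Unary.AllPairs using (AllPairs; []; _∷_)
open import Data.List.Relation.Unary.Any using (here; there)
open import Data.List.Relation.Unary.Linked as Linked using (Linked; []; [-]; _∷_)
open import Data.List.Relation.Unary.Unique.Propositional using (Unique)
open import Data.Maybe using (Maybe; just; nothing)
open import Data.Maybe.Properties using (just-injective) renaming (≡-dec to ≡-dec-Maybe)
open import Data.Nat using (ℕ; zero; suc; _≤_; _<_; _+_; _*_; s≤s)
open import Data.Nat.Divisibility using (_∣_; _∣0; n∣n; ∣m∣n⇒∣m+n)
open import Data.Nat.Properties
  using (≤-refl; ≤-reflexive; ≤-trans; ≤-pred; <-≤-trans; ≤-antisym; <-trans; <-irrefl; <-asym; <⇒≢; <⇒≤; n≤1+n; m≤n+m;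
         suc-injective; +-suc; +-comm; +-identityʳ; +-monoˡ-≤; *-suc; *-monoʳ-≤)
import Data.Product as Product
open import Data.Product using (Σ-syntax; _×_; _,_; ∃-syntax; proj₁; proj₂)
open import Data.Sum using (_⊎_; inj₁; inj₂; [_,_]; swap)
open import Data.Unit using (tt) renaming (⊤ to Unit)
import Data.Vec.Base as Vec
open Vec using (_∷_)
open import Data.Vec.Functional using (updateAt)
open import Data.Vec.Functional.Properties using (updateAt-updates; updateAt-minimal)
open import Data.Vec.Properties using (lookup∘tabulate; []=⇒lookup; lookup⇒[]=)
open import Function using (id; const; _∘_)
open import Function.Bundles using (Equivalence)
open import Relation.Nullary using (¬_; Dec; yes; no)
open import Relation.Nullary.Decidable using (dec-true; _×-dec_; _⊎-dec_)
open import Relation.Binary.PropositionalEquality using (_≡_; _≢_; refl; sym; trans; cong; subst; subst₂)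

module _ {A : Set} where

  NonBacktracking : List A → Set
  NonBacktracking (a ∷ b ∷ c ∷ l) = a ≢ c × NonBacktracking (b ∷ c ∷ l)
  NonBacktracking _               = Unit

  nonBacktracking-∷ʳ : ∀ xs {z} → Unique xs → All (z ≢_) xs → NonBacktracking (xs ++ z ∷ [])
  nonBacktracking-∷ʳ []              _                      _         = tt
  nonBacktracking-∷ʳ (_ ∷ [])        _                      _         = tt
  nonBacktracking-∷ʳ (_ ∷ _ ∷ [])    _                      (z≢a ∷ _) = z≢a ∘ sym , tt
  nonBacktracking-∷ʳ (_ ∷ b ∷ c ∷ l) ((_ ∷ a≢c ∷ _) ∷ uniq) (_ ∷ z∉)  =
    a≢c , nonBacktracking-∷ʳ (b ∷ c ∷ l) uniq z∉

  final : A → List A → A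
  final a []      = a
  final _ (b ∷ l) = final b l

  penultimate : A → A → List A → A
  penultimate a _ []      = a
  penultimate _ b (c ∷ l) = penultimate b c l

  final-∷ʳ : ∀ a l z → final a (l ++ z ∷ []) ≡ z
  final-∷ʳ _ []      _ = refl
  final-∷ʳ _ (b ∷ l) z = final-∷ʳ b l z

  penultimate-∷ʳ : ∀ a b l z → penultimate a b (l ++ z ∷ []) ≡ final b l
  penultimate-∷ʳ _ _ []      _ = refl
  penultimate-∷ʳ _ b (c ∷ l) z = penultimate-∷ʳ b c l z

  final-∈ : ∀ a l → final a l ∈ˡ a ∷ l
  final-∈ a []      = here refl
  final-∈ _ (b ∷ l) = there (final-∈ b l)

  module _ {R : A → A → Set} where

    last-step : ∀ a b l → Linked R (a ∷ b ∷ l) → R (penultimate a b l) (final b l)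
    last-step _ _ []      (r ∷ [-]) = r
    last-step _ b (c ∷ l) (_ ∷ rs)  = last-step b c l rs

    Linked-prefix-∷ʳ : ∀ xs {z ys c} → Linked R (xs ++ z ∷ ys) → R z c → Linked R (xs ++ z ∷ c ∷ [])
    Linked-prefix-∷ʳ []           _        r = r ∷ [-]
    Linked-prefix-∷ʳ (_ ∷ [])     (r ∷ rs) s = r ∷ Linked-prefix-∷ʳ [] rs s
    Linked-prefix-∷ʳ (_ ∷ y ∷ xs) (r ∷ rs) s = r ∷ Linked-prefix-∷ʳ (y ∷ xs) rs s

  All-prefix : ∀ {P : A → Set} xs {z ys} → All P (xs ++ z ∷ ys) → All P (xs ++ z ∷ [])
  All-prefix []       (pz ∷ _)  = pz ∷ []
  All-prefix (_ ∷ xs) (px ∷ ps) = px ∷ All-prefix xs ps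

  AllPairs-prefix : ∀ {R : A → A → Set} xs {z ys} → AllPairs R (xs ++ z ∷ ys) → AllPairs R (xs ++ z ∷ [])
  AllPairs-prefix []       (_ ∷ _)   = [] ∷ []
  AllPairs-prefix (_ ∷ xs) (px ∷ ps) = All-prefix xs px ∷ AllPairs-prefix xs ps

module _ {n : ℕ} {P : Fin n → Set} {E : Fin n → Fin n → Set} where

  _++ʷ_ : ∀ {u v w} → Walk P E u v → Walk P E v w → Walk P E u w
  here _      ++ʷ q = q
  step pu e p ++ʷ q = step pu e (p ++ʷ q)

  walk-source : ∀ {u v} → Walk P E u v → P u
  walk-source (here pu)     = pu
  walk-source (step pu _ _) = pu

  reverseʷ : (∀ {u v} → E u v → E v u) → ∀ {u v} → Walk P E u v → Walk P E v u
  reverseʷ _     (here pu)     = here pu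
  reverseʷ sym-E (step pu e p) = reverseʷ sym-E p ++ʷ step (walk-source p) (sym-E e) (here pu)

  crossing-edge : ∀ {Q : Fin n → Set} → (∀ u → Dec (Q u)) → ∀ {u v} → Walk P E u v → ¬ Q u → Q v →
                  ∃[ a ] ∃[ b ] (¬ Q a × Q b × E a b)
  crossing-edge Q? (here _)            ¬qu qv = ⊥-elim (¬qu qv)
  crossing-edge Q? (step {u} {w} _ e p) ¬qu qv with Q? w
  ... | yes qw = u , w , ¬qu , qw , e
  ... | no ¬qw = crossing-edge Q? p ¬qw qv

  module _ (acyclic : AcyclicOn P E) where

    no-chord-from-start : ∀ {c y rest z} → Unique (c ∷ y ∷ rest) → All P (c ∷ y ∷ rest) →
                          Linked E (c ∷ y ∷ rest) → z ∈ˡ rest → ¬ E z c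
    no-chord-from-start {c} {y} {z = z} uniq in-P walk z∈rest z–c with ∈-∃++ z∈rest
    ... | pre , _ , refl =
      acyclic c (y ∷ pre ++ z ∷ []) (s≤s (length-++-≤ʳ (z ∷ []) {pre}))
        (AllPairs-prefix (c ∷ y ∷ pre) uniq) (All-prefix (c ∷ y ∷ pre) in-P)
        (subst (λ l → Linked E (c ∷ y ∷ l)) (sym (++-assoc pre (z ∷ []) (c ∷ [])))
               (Linked-prefix-∷ʳ (c ∷ y ∷ pre) walk z–c))

    start-has-one-neighbour : ∀ {c rest a b} → Unique (c ∷ rest) → All P (c ∷ rest) → Linked E (c ∷ rest) →
                              a ∈ˡ c ∷ rest → a ≢ c → E a c → b ∈ˡ c ∷ rest → b ≢ c → E b c → a ≡ b
    start-has-one-neighbour {rest = []}    _ _ _ (here a≡c) a≢c _ _ _ _ = ⊥-elim (a≢c a≡c)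
    start-has-one-neighbour {rest = y ∷ _} uniq in-P walk a∈ a≢c a–c b∈ b≢c b–c =
      trans (second a∈ a≢c a–c) (sym (second b∈ b≢c b–c))
      where
      second : ∀ {z} → z ∈ˡ _ → z ≢ _ → E z _ → z ≡ y
      second (here z≡c)          z≢c _   = ⊥-elim (z≢c z≡c)
      second (there (here z≡y))  _   _   = z≡y
      second (there (there z∈))  _   z–c = ⊥-elim (no-chord-from-start uniq in-P walk z∈ z–c)

∣p∪⁅x⁆∣≡1+∣p∣ : ∀ {n} (p : Subset n) {x} → x ∉ p → ∣ p ∪ ⁅ x ⁆ ∣ ≡ suc ∣ p ∣
∣p∪⁅x⁆∣≡1+∣p∣ (true  ∷ p) {fzero}  x∉p = ⊥-elim (x∉p Vec.here)
∣p∪⁅x⁆∣≡1+∣p∣ (false ∷ p) {fzero}  _   = cong (suc ∘ ∣_∣) (∪-identityʳ p)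
∣p∪⁅x⁆∣≡1+∣p∣ (true  ∷ p) {fsuc x} x∉p = cong suc (∣p∪⁅x⁆∣≡1+∣p∣ p (x∉p ∘ Vec.there))
∣p∪⁅x⁆∣≡1+∣p∣ (false ∷ p) {fsuc x} x∉p = ∣p∪⁅x⁆∣≡1+∣p∣ p (x∉p ∘ Vec.there)

module _ {n : ℕ} where

  x∈p∪⁅y⁆⇒x∈p : ∀ {p : Subset n} {x y} → x ≢ y → x ∈ p ∪ ⁅ y ⁆ → x ∈ p
  x∈p∪⁅y⁆⇒x∈p {p} {y = y} x≢y x∈ with x∈p∪q⁻ p ⁅ y ⁆ x∈
  ... | inj₁ x∈p = x∈p
  ... | inj₂ x∈y = ⊥-elim (x≢y (x∈⁅y⁆⇒x≡y y x∈y))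

  n≤∣p∣⇒x∈p : ∀ {p : Subset n} {x} → n ≤ ∣ p ∣ → x ∈ p
  n≤∣p∣⇒x∈p {p} full = subst (_ ∈_) (sym (∣p∣≡n⇒p≡⊤ (≤-antisym (∣p∣≤n p) full))) ∈⊤

  ∣p∣≡1 : ∀ {p : Subset n} {a} → a ∈ p → (∀ {x} → x ∈ p → x ≡ a) → ∣ p ∣ ≡ 1
  ∣p∣≡1 {p} {a} a∈p only-a =
    trans (cong ∣_∣ (⊆-antisym (λ x∈p → subst (_∈ ⁅ a ⁆) (sym (only-a x∈p)) (x∈⁅x⁆ a))
                               (λ x∈a → subst (_∈ p) (sym (x∈⁅y⁆⇒x≡y a x∈a)) a∈p)))
          (∣⁅x⁆∣≡1 a)

  ∣p∣≡2 : ∀ {p : Subset n} {a b} → a ≢ b → a ∈ p → b ∈ p → (∀ {x} → x ∈ p → x ≡ a ⊎ x ≡ b) → ∣ p ∣ ≡ 2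
  ∣p∣≡2 {p} {a} {b} a≢b a∈p b∈p only-ab =
    trans (cong ∣_∣ (⊆-antisym p⊆ab ab⊆p))
          (trans (∣p∪⁅x⁆∣≡1+∣p∣ ⁅ a ⁆ (a≢b ∘ sym ∘ x∈⁅y⁆⇒x≡y a)) (cong suc (∣⁅x⁆∣≡1 a)))
    where
    p⊆ab : p ⊆ ⁅ a ⁆ ∪ ⁅ b ⁆
    p⊆ab x∈p with only-ab x∈p
    ... | inj₁ refl = x∈p∪q⁺ (inj₁ (x∈⁅x⁆ a))
    ... | inj₂ refl = x∈p∪q⁺ (inj₂ (x∈⁅x⁆ b))
    ab⊆p : ⁅ a ⁆ ∪ ⁅ b ⁆ ⊆ p
    ab⊆p x∈ab with x∈p∪q⁻ ⁅ a ⁆ ⁅ b ⁆ x∈ab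
    ... | inj₁ x∈a = subst (_∈ p) (sym (x∈⁅y⁆⇒x≡y a x∈a)) a∈p
    ... | inj₂ x∈b = subst (_∈ p) (sym (x∈⁅y⁆⇒x≡y b x∈b)) b∈p

module _ {n : ℕ} (T : Graph n) where

  ∈-Nbhd⁺ : ∀ {v x} → Adj T v x → x ∈ Nbhd T v
  ∈-Nbhd⁺ {v} {x} v–x = lookup⇒[]= x _ (trans (lookup∘tabulate _ x) (dec-true (adj? T v x) v–x))

  ∈-Nbhd⁻ : ∀ {v x} → x ∈ Nbhd T v → Adj T v x
  ∈-Nbhd⁻ {v} {x} x∈N with adj? T v x | trans (sym (lookup∘tabulate _ x)) ([]=⇒lookup x∈N)
  ... | yes v–x | _ = v–x
  ... | no _    | ()

  degree≡1 : ∀ {v a} → Adj T v a → (∀ {x} → Adj T v x → x ≡ a) → degree T v ≡ 1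
  degree≡1 v–a only-a = ∣p∣≡1 (∈-Nbhd⁺ v–a) (only-a ∘ ∈-Nbhd⁻)

  degIn≡2 : ∀ {S v a b} → a ≢ b → a ∈ S → Adj T v a → b ∈ S → Adj T v b →
            (∀ {x} → x ∈ S → Adj T v x → x ≡ a ⊎ x ≡ b) → degIn S T v ≡ 2
  degIn≡2 {S} {v} a≢b a∈S v–a b∈S v–b only-ab =
    ∣p∣≡2 a≢b (x∈p∩q⁺ (a∈S , ∈-Nbhd⁺ v–a)) (x∈p∩q⁺ (b∈S , ∈-Nbhd⁺ v–b))
      (λ x∈ → let (x∈S , x∈N) = x∈p∩q⁻ S (Nbhd T v) x∈ in only-ab x∈S (∈-Nbhd⁻ x∈N))

module _ {n : ℕ} where

  Straddles : Subset n → Fin n → Fin n → Set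
  Straddles I u v = (u ∈ I ⊎ v ∈ I) × ¬ (u ∈ I × v ∈ I)

  straddles-sym : ∀ {I u v} → Straddles I u v → Straddles I v u
  straddles-sym (one , ¬both) = swap one , ¬both ∘ Product.swap

  straddles-∈ : ∀ {I u v} → Straddles I u v → u ∈ I → v ∉ I
  straddles-∈ (_ , ¬both) u∈I v∈I = ¬both (u∈I , v∈I)

  straddles-∉ : ∀ {I u v} → Straddles I u v → u ∉ I → v ∈ I
  straddles-∉ (inj₁ u∈I , _) u∉I = ⊥-elim (u∉I u∈I)
  straddles-∉ (inj₂ v∈I , _) _   = v∈I

module Alternation {n : ℕ} (I : Subset n) {R : Fin n → Fin n → Set}
                   (straddles : ∀ {u v} → R u v → Straddles I u v) where

  private
    2∣2+ : ∀ {k} → 2 ∣ k → 2 ∣ suc (suc k)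
    2∣2+ = ∣m∣n⇒∣m+n n∣n

  parity-at : ∀ {x} xs → Linked R (x ∷ xs) → ∀ i → lookup (x ∷ xs) i ∈ I →
              (x ∈ I → 2 ∣ toℕ i) × (x ∉ I → 2 ∣ suc (toℕ i))
  parity-at _        _            fzero    x∈I = (λ _ → 2 ∣0) , (λ x∉I → ⊥-elim (x∉I x∈I))
  parity-at (_ ∷ ys) (x–y ∷ walk) (fsuc i) at∈I with parity-at ys walk i at∈I
  ... | from-in , from-out =
    (λ x∈I → from-out (straddles-∈ (straddles x–y) x∈I)) ,
    (λ x∉I → 2∣2+ (from-in (straddles-∉ (straddles x–y) x∉I)))

  parity-at-end : ∀ {x} mid {z} → Linked R (x ∷ mid ++ z ∷ []) → z ∈ I →
                  (x ∈ I → 2 ∣ suc (length mid)) × (x ∉ I → 2 ∣ length mid)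
  parity-at-end []        (x–z ∷ [-])  z∈I =
    (λ x∈I → ⊥-elim (straddles-∈ (straddles x–z) x∈I z∈I)) , (λ _ → 2 ∣0)
  parity-at-end (_ ∷ mid) (x–y ∷ walk) z∈I with parity-at-end mid walk z∈I
  ... | from-in , from-out =
    (λ x∈I → 2∣2+ (from-out (straddles-∈ (straddles x–y) x∈I))) ,
    (λ x∉I → from-in (straddles-∉ (straddles x–y) x∉I))

module ParentForest {n : ℕ} (parent : Fin n → Maybe (Fin n)) (rank : Fin n → ℕ)
                    (rank-parent : ∀ {u v} → parent u ≡ just v → rank v < rank u) where

  Edge : Fin n → Fin n → Set
  Edge u v = parent u ≡ just v ⊎ parent v ≡ just u

  forest : Graph n
  forest = record
    { Adj    = Edge
    ; adj?   = λ u v → ≡-dec-Maybe _≟_ (parent u) (just v) ⊎-dec ≡-dec-Maybe _≟_ (parent v) (just u)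
    ; sym    = swap
    ; irrefl = λ { (inj₁ u↑u) → <-irrefl refl (rank-parent u↑u) ; (inj₂ u↑u) → <-irrefl refl (rank-parent u↑u) }
    }

  parent-unique : ∀ {u v w} → parent u ≡ just v → parent u ≡ just w → v ≡ w
  parent-unique u↑v u↑w = just-injective (trans (sym u↑v) u↑w)

  -- In a non-backtracking walk a step down (to a child) is never followed by a step up, so the
  -- walk climbs towards the root and then only descends. Around a cycle this forces the rank to
  -- change monotonically, or both cycle edges at the start vertex to lead to its parent.
  climbing-walk : ∀ a b l → NonBacktracking (a ∷ b ∷ l) → Linked Edge (a ∷ b ∷ l) →
                  parent (penultimate a b l) ≡ just (final b l) → parent a ≡ just b × rank (final b l) < rank a
  climbing-walk _ _ []      _          _            up = up , rank-parent up
  climbing-walk _ b (c ∷ l) (a≢c , nb) (a–b ∷ walk) up with climbing-walk b c l nb walk up | a–b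
  ... | b↑c , below-b | inj₁ a↑b = a↑b , <-trans below-b (rank-parent a↑b)
  ... | b↑c , _       | inj₂ b↑a = ⊥-elim (a≢c (parent-unique b↑a b↑c))

  descending-walk : ∀ a b l → NonBacktracking (a ∷ b ∷ l) → Linked Edge (a ∷ b ∷ l) →
                    parent b ≡ just a → rank a < rank (final b l)
  descending-walk _ _ []      _          _                     b↑a = rank-parent b↑a
  descending-walk _ b (c ∷ l) (a≢c , nb) (_ ∷ walk@(b–c ∷ _)) b↑a with b–c
  ... | inj₁ b↑c = ⊥-elim (a≢c (parent-unique b↑a b↑c))
  ... | inj₂ c↑b = <-trans (rank-parent b↑a) (descending-walk b c l nb walk c↑b)

  acyclic : (P : Fin n → Set) → AcyclicOn P Edge
  acyclic _ _ (_ ∷ [])     (s≤s ()) _ _ _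
  acyclic _ x (y ∷ z ∷ zs) _ (x∉@(_ ∷ x≢z ∷ _) ∷ uniq@(y∉ ∷ _)) _ walk =
    impossible (Linked.head walk) (last-step x y around walk)
    where
    around : List (Fin n)
    around = z ∷ zs ++ x ∷ []
    closes : final y around ≡ x
    closes = final-∷ʳ y (z ∷ zs) x
    nb : NonBacktracking (x ∷ y ∷ around)
    nb = x≢z , nonBacktracking-∷ʳ (y ∷ z ∷ zs) uniq x∉
    impossible : Edge x y → Edge (penultimate x y around) (final y around) → ⊥
    impossible (inj₂ y↑x) _          = <-irrefl (cong rank (sym closes)) (descending-walk x y around nb walk y↑x)
    impossible (inj₁ x↑y) (inj₁ up)   = <-irrefl (cong rank closes) (proj₂ (climbing-walk x y around nb walk up))
    impossible (inj₁ x↑y) (inj₂ down) = All.lookup y∉ (final-∈ z zs) (parent-unique x↑y x↑ym)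
      where
      x↑ym : parent x ≡ just (final z zs)
      x↑ym = subst₂ (λ a b → parent a ≡ just b) closes (penultimate-∷ʳ x y (z ∷ zs) x) down

  module _ (P : Fin n → Set) (r : Fin n) (P-r : P r)
           (P-parent : ∀ {u v} → P u → parent u ≡ just v → P v)
           (rooted : ∀ {u} → P u → u ≡ r ⊎ ∃[ v ] parent u ≡ just v) where

    walk-to-root : ∀ k u → rank u < k → P u → Walk P Edge u r
    walk-to-root (suc k) u below pu with rooted pu
    ... | inj₁ refl       = here pu
    ... | inj₂ (v , u↑v) =
      step pu (inj₁ u↑v) (walk-to-root k v (<-≤-trans (rank-parent u↑v) (≤-pred below)) (P-parent pu u↑v))

    connected : ConnectedOn P Edge
    connected = (r , P-r) , λ u v pu pv →
      walk-to-root _ u ≤-refl pu ++ʷ reverseʷ swap (walk-to-root _ v ≤-refl pv)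

  degree-leaf : ∀ {w i} → parent w ≡ just i → (∀ {u} → parent u ≢ just w) → degree forest w ≡ 1
  degree-leaf w↑i childless = degree≡1 forest (inj₁ w↑i) λ
    { (inj₁ w↑x) → parent-unique w↑x w↑i
    ; (inj₂ x↑w) → ⊥-elim (childless x↑w) }

  degIn-parent-and-only-child : ∀ {S c p q} → parent c ≡ just p → p ∈ S → parent q ≡ just c → q ∈ S →
                                (∀ {x} → x ∈ S → parent x ≡ just c → x ≡ q) → degIn S forest c ≡ 2
  degIn-parent-and-only-child {p = p} {q} c↑p p∈S q↑c q∈S only-q =
    degIn≡2 forest p≢q p∈S (inj₁ c↑p) q∈S (inj₂ q↑c) λ
      { x∈S (inj₁ c↑x) → inj₁ (parent-unique c↑x c↑p)
      ; x∈S (inj₂ x↑c) → inj₂ (only-q x∈S x↑c) }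
    where
    p≢q : p ≢ q
    p≢q refl = <-asym (rank-parent c↑p) (rank-parent q↑c)

module Growth {n : ℕ} (G : Graph n) (r : Fin n) where

  Dominated : Subset n → Fin n → Set
  Dominated I u = u ∈ I ⊎ ∃[ i ] (i ∈ I × Adj G u i)

  dominated? : ∀ I u → Dec (Dominated I u)
  dominated? I u = (u ∈? I) ⊎-dec any? (λ i → (i ∈? I) ×-dec adj? G u i)

  independent-∪⁅⁆ : ∀ {I v} → Independent G I → ¬ Dominated I v → Independent G (I ∪ ⁅ v ⁆)
  independent-∪⁅⁆ {I} {v} independent v-free a b a∈ b∈ with x∈p∪q⁻ I ⁅ v ⁆ a∈ | x∈p∪q⁻ I ⁅ v ⁆ b∈
  ... | inj₁ a∈I | inj₁ b∈I = independent a b a∈I b∈I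
  ... | inj₁ a∈I | inj₂ b∈v rewrite x∈⁅y⁆⇒x≡y v b∈v = λ a–v → v-free (inj₂ (a , a∈I , Graph.sym G a–v))
  ... | inj₂ a∈v | inj₁ b∈I rewrite x∈⁅y⁆⇒x≡y v a∈v = λ v–b → v-free (inj₂ (b , b∈I , v–b))
  ... | inj₂ a∈v | inj₂ b∈v rewrite x∈⁅y⁆⇒x≡y v a∈v | x∈⁅y⁆⇒x≡y v b∈v = irrefl G

  -- The tree T̄ on S, rooted at r, with I the colour class of r; I must be independent in G itself.
  record ColouredTree : Set where
    field
      S I              : Subset n
      parent           : Fin n → Maybe (Fin n)
      rank             : Fin n → ℕ
      root∈I           : r ∈ I
      I⊆S              : I ⊆ S
      parent-∈S        : ∀ {u v} → parent u ≡ just v → u ∈ S × v ∈ S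
      parent-adj       : ∀ {u v} → parent u ≡ just v → Adj G u v
      rank-parent      : ∀ {u v} → parent u ≡ just v → rank v < rank u
      parent-straddles : ∀ {u v} → parent u ≡ just v → Straddles I u v
      rooted           : ∀ {u} → u ∈ S → u ≡ r ⊎ ∃[ v ] parent u ≡ just v
      I-independent    : Independent G I

    has-parent : ∀ {u} → u ∈ S → u ∉ I → ∃[ v ] parent u ≡ just v
    has-parent u∈S u∉I with rooted u∈S
    ... | inj₁ refl     = ⊥-elim (u∉I root∈I)
    ... | inj₂ has-one = has-one

    S-dominated : ∀ {u} → u ∈ S → Dominated I u
    S-dominated {u} u∈S with u ∈? I
    ... | yes u∈I = inj₁ u∈I
    ... | no u∉I  = let (v , u↑v) = has-parent u∈S u∉I in
                    inj₂ (v , straddles-∉ (parent-straddles u↑v) u∉I , parent-adj u↑v)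

  size : ColouredTree → ℕ
  size T = ∣ ColouredTree.S T ∣

  HasUniqueChild : ColouredTree → Fin n → Set
  HasUniqueChild T c = ∃[ q ] (parent q ≡ just c × ∀ {q′} → parent q′ ≡ just c → q′ ≡ q)
    where open ColouredTree T

  Extremal : ColouredTree → Set
  Extremal T = ∀ {c} → c ∈ S → c ∉ I → HasUniqueChild T c
    where open ColouredTree T

  Balanced : ColouredTree → Set
  Balanced T = suc ∣ S ∣ ≤ 2 * ∣ I ∣ × (suc ∣ S ∣ ≡ 2 * ∣ I ∣ → Extremal T)
    where open ColouredTree T

  free-neighbour-∉ : ∀ {I v p} → ¬ Dominated I v → Adj G v p → p ∉ I ∪ ⁅ v ⁆
  free-neighbour-∉ {v = v} {p} v-free v–p p∈ with p ≟ v
  ... | yes refl = irrefl G v–p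
  ... | no p≢v   = v-free (inj₂ (p , x∈p∪⁅y⁆⇒x∈p p≢v p∈ , v–p))

  module _ (T : ColouredTree) where
    open ColouredTree T

    module Graft {v p : Fin n}
                 (v∉S : v ∉ S) (p∈S : p ∈ S) (v–p : Adj G v p)
                 (I⁺ : Subset n) (I⊆I⁺ : I ⊆ I⁺) (I⁺⊆I : ∀ {u} → u ≢ v → u ∈ I⁺ → u ∈ I)
                 (v–p-straddles : Straddles I⁺ v p) (I⁺-independent : Independent G I⁺) where

      S⁺ : Subset n
      S⁺ = S ∪ ⁅ v ⁆

      parent⁺ : Fin n → Maybe (Fin n)
      parent⁺ = updateAt parent v (const (just p))

      rank⁺ : Fin n → ℕ
      rank⁺ = updateAt rank v (const (suc (rank p)))

      private
        S⇒≢v : ∀ {u} → u ∈ S → u ≢ v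
        S⇒≢v u∈S refl = v∉S u∈S

        S⊆S⁺ : S ⊆ S⁺
        S⊆S⁺ = p⊆p∪q _

      v∈S⁺ : v ∈ S⁺
      v∈S⁺ = x∈p∪q⁺ (inj₂ (x∈⁅x⁆ v))

      parent⁺-v : parent⁺ v ≡ just p
      parent⁺-v = updateAt-updates v parent

      rank⁺-v : rank⁺ v ≡ suc (rank p)
      rank⁺-v = updateAt-updates v rank

      parent⁺-S : ∀ {u} → u ∈ S → parent⁺ u ≡ parent u
      parent⁺-S u∈S = updateAt-minimal _ v parent (S⇒≢v u∈S)

      rank⁺-S : ∀ {u} → u ∈ S → rank⁺ u ≡ rank u
      rank⁺-S u∈S = updateAt-minimal _ v rank (S⇒≢v u∈S)

      parent⁺-cases : ∀ {u w} → parent⁺ u ≡ just w → (u ≡ v × w ≡ p) ⊎ (u ∈ S × parent u ≡ just w)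
      parent⁺-cases {u} u↑w with u ≟ v
      ... | yes refl = inj₁ (refl , just-injective (trans (sym u↑w) parent⁺-v))
      ... | no u≢v   = let u↑w′ = trans (sym (updateAt-minimal u v parent u≢v)) u↑w in
                       inj₂ (proj₁ (parent-∈S u↑w′) , u↑w′)

      I⁺⊆S⁺ : I⁺ ⊆ S⁺
      I⁺⊆S⁺ {u} u∈I⁺ with u ≟ v
      ... | yes refl = v∈S⁺
      ... | no u≢v   = S⊆S⁺ (I⊆S (I⁺⊆I u≢v u∈I⁺))

      parent⁺-∈S⁺ : ∀ {u w} → parent⁺ u ≡ just w → u ∈ S⁺ × w ∈ S⁺
      parent⁺-∈S⁺ u↑w with parent⁺-cases u↑w
      ... | inj₁ (refl , refl) = v∈S⁺ , S⊆S⁺ p∈S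
      ... | inj₂ (_ , u↑w′)    = let (u∈S , w∈S) = parent-∈S u↑w′ in S⊆S⁺ u∈S , S⊆S⁺ w∈S

      parent⁺-adj : ∀ {u w} → parent⁺ u ≡ just w → Adj G u w
      parent⁺-adj u↑w with parent⁺-cases u↑w
      ... | inj₁ (refl , refl) = v–p
      ... | inj₂ (_ , u↑w′)    = parent-adj u↑w′

      rank⁺-parent⁺ : ∀ {u w} → parent⁺ u ≡ just w → rank⁺ w < rank⁺ u
      rank⁺-parent⁺ u↑w with parent⁺-cases u↑w
      ... | inj₁ (refl , refl) = subst₂ _<_ (sym (rank⁺-S p∈S)) (sym rank⁺-v) ≤-refl
      ... | inj₂ (u∈S , u↑w′)  =
        subst₂ _<_ (sym (rank⁺-S (proj₂ (parent-∈S u↑w′)))) (sym (rank⁺-S u∈S)) (rank-parent u↑w′)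

      parent⁺-straddles : ∀ {u w} → parent⁺ u ≡ just w → Straddles I⁺ u w
      parent⁺-straddles u↑w with parent⁺-cases u↑w
      ... | inj₁ (refl , refl) = v–p-straddles
      ... | inj₂ (u∈S , u↑w′)  with parent-straddles u↑w′
      ...   | one , ¬both =
        [ inj₁ ∘ I⊆I⁺ , inj₂ ∘ I⊆I⁺ ] one ,
        λ (u∈ , w∈) → ¬both (I⁺⊆I (S⇒≢v u∈S) u∈ , I⁺⊆I (S⇒≢v (proj₂ (parent-∈S u↑w′))) w∈)

      rooted⁺ : ∀ {u} → u ∈ S⁺ → u ≡ r ⊎ ∃[ w ] parent⁺ u ≡ just w
      rooted⁺ {u} u∈S⁺ with x∈p∪q⁻ S ⁅ v ⁆ u∈S⁺
      ... | inj₂ u∈v = inj₂ (p , subst (λ x → parent⁺ x ≡ just p) (sym (x∈⁅y⁆⇒x≡y v u∈v)) parent⁺-v)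
      ... | inj₁ u∈S with rooted u∈S
      ...   | inj₁ u≡r        = inj₁ u≡r
      ...   | inj₂ (w , u↑w) = inj₂ (w , trans (parent⁺-S u∈S) u↑w)

      tree : ColouredTree
      tree = record
        { S                = S⁺
        ; I                = I⁺
        ; parent           = parent⁺
        ; rank             = rank⁺
        ; root∈I           = I⊆I⁺ root∈I
        ; I⊆S              = I⁺⊆S⁺
        ; parent-∈S        = parent⁺-∈S⁺
        ; parent-adj       = parent⁺-adj
        ; rank-parent      = rank⁺-parent⁺
        ; parent-straddles = parent⁺-straddles
        ; rooted           = rooted⁺
        ; I-independent    = I⁺-independent
        }

      ∣S⁺∣ : ∣ S⁺ ∣ ≡ suc ∣ S ∣
      ∣S⁺∣ = ∣p∪⁅x⁆∣≡1+∣p∣ S v∉S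

      v-childless : ∀ {u} → parent⁺ u ≢ just v
      v-childless u↑v with parent⁺-cases u↑v
      ... | inj₁ (_ , v≡p)  = v∉S (subst (_∈ S) (sym v≡p) p∈S)
      ... | inj₂ (_ , u↑v′) = v∉S (proj₂ (parent-∈S u↑v′))

      unique-child-kept : ∀ {c} → c ≢ p → HasUniqueChild T c → HasUniqueChild tree c
      unique-child-kept c≢p (q , q↑c , only-q) = q , trans (parent⁺-S (proj₁ (parent-∈S q↑c))) q↑c , λ q′↑c →
        [ (λ (_ , c≡p) → ⊥-elim (c≢p c≡p)) , only-q ∘ proj₂ ] (parent⁺-cases q′↑c)

      unique-child-new : (∀ {u} → parent u ≢ just p) → HasUniqueChild tree p
      unique-child-new childless = v , parent⁺-v , λ u↑p →
        [ proj₁ , ⊥-elim ∘ childless ∘ proj₂ ] (parent⁺-cases u↑p)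

    module GraftOut {v p : Fin n} (v∉S : v ∉ S) (p∈I : p ∈ I) (v–p : Adj G v p) =
      Graft v∉S (I⊆S p∈I) v–p I id (λ _ → id) (inj₂ p∈I , v∉S ∘ I⊆S ∘ proj₁) I-independent

    module GraftIn {v p : Fin n} (v-free : ¬ Dominated I v) (p∈S : p ∈ S) (v–p : Adj G v p) =
      Graft (v-free ∘ S-dominated) p∈S v–p (I ∪ ⁅ v ⁆) (p⊆p∪q _) x∈p∪⁅y⁆⇒x∈p
            (inj₁ (x∈p∪q⁺ (inj₂ (x∈⁅x⁆ v))) , free-neighbour-∉ v-free v–p ∘ proj₂)
            (independent-∪⁅⁆ I-independent v-free)

  BalancedExtension : ColouredTree → Set
  BalancedExtension T = Σ[ T′ ∈ ColouredTree ] (Balanced T′ × size T < size T′)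

  module _ (T : ColouredTree) (balanced : Balanced T) where
    open ColouredTree T

    private
      2∣I∪⁅x⁆∣ : ∀ {x} → x ∉ I → 2 * ∣ I ∪ ⁅ x ⁆ ∣ ≡ 2 + 2 * ∣ I ∣
      2∣I∪⁅x⁆∣ x∉I = trans (cong (2 *_) (∣p∪⁅x⁆∣≡1+∣p∣ I x∉I)) (*-suc 2 ∣ I ∣)

    extend-by-one : ∀ {x y} → ¬ Dominated I x → Adj G x y → y ∈ S → BalancedExtension T
    extend-by-one {x} x-free x–y y∈S = tree , (<⇒≤ strict , ⊥-elim ∘ <⇒≢ strict) , ≤-reflexive (sym ∣S⁺∣)
      where
      open GraftIn T x-free y∈S x–y
      strict : suc ∣ S⁺ ∣ < 2 * ∣ I ∪ ⁅ x ⁆ ∣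
      strict = subst₂ _<_ (cong suc (sym ∣S⁺∣)) (sym (2∣I∪⁅x⁆∣ (x-free ∘ inj₁))) (s≤s (s≤s (proj₁ balanced)))

    extend-by-two : ∀ {x y s} → ¬ Dominated I x → Adj G x y → y ∉ S → s ∈ I → Adj G y s → BalancedExtension T
    extend-by-two {x} {y} {s} x-free x–y y∉S s∈I y–s =
      T₂.tree , (bound , extremal) , ≤-trans (n≤1+n _) (≤-reflexive (sym ∣S₂∣))
      where
      module T₁ = GraftOut T y∉S s∈I y–s
      module T₂ = GraftIn T₁.tree x-free T₁.v∈S⁺ x–y
      ∣S₂∣ : ∣ T₂.S⁺ ∣ ≡ suc (suc ∣ S ∣)
      ∣S₂∣ = trans T₂.∣S⁺∣ (cong suc T₁.∣S⁺∣)
      2∣I₂∣ : 2 * ∣ I ∪ ⁅ x ⁆ ∣ ≡ 2 + 2 * ∣ I ∣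
      2∣I₂∣ = 2∣I∪⁅x⁆∣ (x-free ∘ inj₁)
      bound : suc ∣ T₂.S⁺ ∣ ≤ 2 * ∣ I ∪ ⁅ x ⁆ ∣
      bound = subst₂ _≤_ (cong suc (sym ∣S₂∣)) (sym 2∣I₂∣) (s≤s (s≤s (proj₁ balanced)))
      extremal : suc ∣ T₂.S⁺ ∣ ≡ 2 * ∣ I ∪ ⁅ x ⁆ ∣ → Extremal T₂.tree
      extremal tight {c} c∈S₂ c∉I₂ with x∈p∪q⁻ T₁.S⁺ ⁅ x ⁆ c∈S₂
      ... | inj₂ c∈x = ⊥-elim (c∉I₂ (x∈p∪q⁺ (inj₂ c∈x)))
      ... | inj₁ c∈S₁ with x∈p∪q⁻ S ⁅ y ⁆ c∈S₁
      ...   | inj₂ c∈y = subst (HasUniqueChild T₂.tree) (sym (x∈⁅y⁆⇒x≡y y c∈y)) (T₂.unique-child-new T₁.v-childless)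
      ...   | inj₁ c∈S =
        T₂.unique-child-kept (λ { refl → y∉S c∈S }) (T₁.unique-child-kept (λ { refl → c∉I₂ (p⊆p∪q _ s∈I) })
          (proj₂ balanced (suc-injective (suc-injective (trans (cong suc (sym ∣S₂∣)) (trans tight 2∣I₂∣))))
                 c∈S (c∉I₂ ∘ p⊆p∪q _)))

    extend : Connected G → ∀ {u} → ¬ Dominated I u → BalancedExtension T
    extend connected {u} u-free with crossing-edge (dominated? I) (proj₂ connected u r u r) u-free (inj₁ root∈I)
    ... | x , y , x-free , inj₁ y∈I , x–y                 = ⊥-elim (x-free (inj₂ (y , y∈I , x–y)))
    ... | x , y , x-free , inj₂ (s , s∈I , y–s) , x–y with y ∈? S
    ...   | yes y∈S = extend-by-one x-free x–y y∈S
    ...   | no y∉S  = extend-by-two x-free x–y y∉S s∈I y–s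

  record DominatingTree : Set where
    field
      tree       : ColouredTree
      balanced   : Balanced tree
      dominating : ∀ u → Dominated (ColouredTree.I tree) u

  grow-from : Connected G → ∀ k T → Balanced T → n ≤ size T + k → DominatingTree
  grow-from _ zero T balanced full = record
    { tree       = T
    ; balanced   = balanced
    ; dominating = λ _ → S-dominated (n≤∣p∣⇒x∈p (subst (n ≤_) (+-identityʳ _) full))
    }
    where open ColouredTree T
  grow-from connected (suc k) T balanced room with all? (dominated? (ColouredTree.I T))
  ... | yes dominating = record { tree = T ; balanced = balanced ; dominating = dominating }
  ... | no some-free with extend T balanced connected (proj₂ (¬∀⟶∃¬ n _ (dominated? _) some-free))
  ...   | T′ , balanced′ , larger =
    grow-from connected k T′ balanced′ (≤-trans room (≤-trans (≤-reflexive (+-suc (size T) k)) (+-monoˡ-≤ k larger)))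

  singleton : ColouredTree
  singleton = record
    { S                = ⁅ r ⁆
    ; I                = ⁅ r ⁆
    ; parent           = const nothing
    ; rank             = const 0
    ; root∈I           = x∈⁅x⁆ r
    ; I⊆S              = id
    ; parent-∈S        = λ ()
    ; parent-adj       = λ ()
    ; rank-parent      = λ ()
    ; parent-straddles = λ ()
    ; rooted           = inj₁ ∘ x∈⁅y⁆⇒x≡y r
    ; I-independent    = λ u v u∈ v∈ →
        subst₂ (λ a b → ¬ Adj G a b) (sym (x∈⁅y⁆⇒x≡y r u∈)) (sym (x∈⁅y⁆⇒x≡y r v∈)) (irrefl G)
    }

  singleton-balanced : Balanced singleton
  singleton-balanced = subst (λ k → suc k ≤ 2 * k) (sym (∣⁅x⁆∣≡1 r)) ≤-refl , λ _ c∈ c∉ → ⊥-elim (c∉ c∈)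

  grow : Connected G → DominatingTree
  grow connected = grow-from connected n singleton singleton-balanced (m≤n+m n _)

  module Completion (D : DominatingTree) where
    open DominatingTree D
    open ColouredTree tree

    anchor : ∀ {u} → u ∉ S → ∃[ i ] (i ∈ I × Adj G u i)
    anchor {u} u∉S with dominating u
    ... | inj₁ u∈I   = ⊥-elim (u∉S (I⊆S u∈I))
    ... | inj₂ found = found

    -- Opaque, so that an equation parent* u ≡ just v determines the implicit argument u.
    opaque
      parent* : Fin n → Maybe (Fin n)
      parent* u with u ∈? S
      ... | yes _   = parent u
      ... | no u∉S = just (proj₁ (anchor u∉S))

      rank* : Fin n → ℕ
      rank* u with u ∈? S
      ... | yes _   = rank u
      ... | no u∉S = suc (rank (proj₁ (anchor u∉S)))

      parent*-S : ∀ {u} → u ∈ S → parent* u ≡ parent u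
      parent*-S {u} u∈S with u ∈? S
      ... | yes _   = refl
      ... | no u∉S = ⊥-elim (u∉S u∈S)

      rank*-S : ∀ {u} → u ∈ S → rank* u ≡ rank u
      rank*-S {u} u∈S with u ∈? S
      ... | yes _   = refl
      ... | no u∉S = ⊥-elim (u∉S u∈S)

      parent*-outside : ∀ {u} → u ∉ S → ∃[ i ] (parent* u ≡ just i × i ∈ I)
      parent*-outside {u} u∉S with u ∈? S
      ... | yes u∈S  = ⊥-elim (u∉S u∈S)
      ... | no u∉S′ = proj₁ (anchor u∉S′) , refl , proj₁ (proj₂ (anchor u∉S′))

      parent*-cases : ∀ {u v} → parent* u ≡ just v →
                      (u ∈ S × parent u ≡ just v) ⊎ (u ∉ S × v ∈ I × Adj G u v × rank* u ≡ suc (rank v))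
      parent*-cases {u} u↑v with u ∈? S
      ... | yes u∈S = inj₁ (u∈S , u↑v)
      ... | no u∉S with just-injective u↑v
      ...   | refl = inj₂ (u∉S , proj₁ (proj₂ (anchor u∉S)) , proj₂ (proj₂ (anchor u∉S)) , refl)

      rooted* : ∀ {u} → u ≡ r ⊎ ∃[ v ] parent* u ≡ just v
      rooted* {u} with u ∈? S
      ... | no _    = inj₂ (_ , refl)
      ... | yes u∈S = rooted u∈S

    rank*-parent* : ∀ {u v} → parent* u ≡ just v → rank* v < rank* u
    rank*-parent* u↑v with parent*-cases u↑v
    ... | inj₁ (u∈S , u↑v′) =
      subst₂ _<_ (sym (rank*-S (proj₂ (parent-∈S u↑v′)))) (sym (rank*-S u∈S)) (rank-parent u↑v′)
    ... | inj₂ (_ , v∈I , _ , rank-u) = subst₂ _<_ (sym (rank*-S (I⊆S v∈I))) (sym rank-u) ≤-refl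

    open ParentForest parent* rank* rank*-parent* public

    parent*-∈S : ∀ {u v} → parent* u ≡ just v → v ∈ S
    parent*-∈S u↑v with parent*-cases u↑v
    ... | inj₁ (_ , u↑v′)    = proj₂ (parent-∈S u↑v′)
    ... | inj₂ (_ , v∈I , _) = I⊆S v∈I

    parent*-adj : ∀ {u v} → parent* u ≡ just v → Adj G u v
    parent*-adj u↑v with parent*-cases u↑v
    ... | inj₁ (_ , u↑v′)        = parent-adj u↑v′
    ... | inj₂ (_ , _ , u–v , _) = u–v

    edge-straddles : ∀ {u v} → Edge u v → Straddles I u v
    edge-straddles (inj₁ u↑v) = parent*-straddles u↑v
      where
      parent*-straddles : ∀ {u v} → parent* u ≡ just v → Straddles I u v
      parent*-straddles u↑v with parent*-cases u↑v
      ... | inj₁ (_ , u↑v′)      = parent-straddles u↑v′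
      ... | inj₂ (u∉S , v∈I , _) = inj₂ v∈I , u∉S ∘ I⊆S ∘ proj₁
    edge-straddles (inj₂ v↑u) = straddles-sym (edge-straddles (inj₁ v↑u))

    spanning : SpanningTreeOf forest G
    spanning = (λ { _ _ (inj₁ u↑v) → parent*-adj u↑v ; _ _ (inj₂ v↑u) → Graph.sym G (parent*-adj v↑u) })
             , connected AllV r r (λ {_} {v} _ _ → v) (λ _ → rooted*) , acyclic AllV

    core-tree : IsTreeOn (InS S) Edge
    core-tree = connected (InS S) r (I⊆S root∈I) (λ _ → parent*-∈S) (λ _ → rooted*) , acyclic (InS S)

    pendant : ∀ w → w ∉ S → degree forest w ≡ 1 × ∃[ u ] (u ∈ S × Edge w u)
    pendant w w∉S =
      let (i , w↑i , i∈I) = parent*-outside w∉S in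
      degree-leaf w↑i (w∉S ∘ parent*-∈S) , i , I⊆S i∈I , inj₁ w↑i

    pendant-neighbour-∈I : ∀ {w v} → w ∉ S → Edge w v → v ∈ I
    pendant-neighbour-∈I w∉S (inj₂ v↑w) = ⊥-elim (w∉S (parent*-∈S v↑w))
    pendant-neighbour-∈I w∉S (inj₁ w↑v) with parent*-cases w↑v
    ... | inj₁ (w∈S , _)     = ⊥-elim (w∉S w∈S)
    ... | inj₂ (_ , v∈I , _) = v∈I

    open Alternation I edge-straddles

    module _ (extremal : Extremal tree) where

      degree-two : ∀ {c} → c ∈ S → c ∉ I → degIn S forest c ≡ 2
      degree-two c∈S c∉I with has-parent c∈S c∉I | extremal c∈S c∉I
      ... | _ , c↑p | q , q↑c , only-q =
        degIn-parent-and-only-child (trans (parent*-S c∈S) c↑p) (proj₂ (parent-∈S c↑p))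
          (trans (parent*-S q∈S) q↑c) q∈S (λ x∈S x↑c → only-q (trans (sym (parent*-S x∈S)) x↑c))
        where
        q∈S : q ∈ S
        q∈S = proj₁ (parent-∈S q↑c)

      ∈I-unless-degree-two : ∀ {c} → c ∈ S → degIn S forest c ≢ 2 → c ∈ I
      ∈I-unless-degree-two {c} c∈S deg≢2 with c ∈? I
      ... | yes c∈I = c∈I
      ... | no c∉I  = ⊥-elim (deg≢2 (degree-two c∈S c∉I))

      paths-even : PendentInternalPathsEven S forest
      paths-even x₀ mid xₖ (_ , in-S , walk) deg-x₀ _ deg-xₖ = proj₁ (parity-at-end mid walk xₖ∈I) x₀∈I
        where
        x₀∈I : x₀ ∈ I
        x₀∈I = ∈I-unless-degree-two (All.head in-S) (λ d≡2 → <⇒≢ deg-x₀ (sym d≡2))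
        xₖ∈I : xₖ ∈ I
        xₖ∈I = ∈I-unless-degree-two (All.head (++⁻ʳ (x₀ ∷ mid) in-S))
                 ([ (λ 3≤d d≡2 → <⇒≢ 3≤d (sym d≡2)) , (λ d≡1 d≡2 → 1≢2 (trans (sym d≡1) d≡2)) ] deg-xₖ)
          where
          1≢2 : 1 ≢ 2
          1≢2 ()

      path-start-∈I : ∀ {c rest} → IsPathListing S forest (c ∷ rest) → c ∈ I
      path-start-∈I {c} ((uniq , in-S , walk) , listing) with c ∈? I
      ... | yes c∈I = c∈I
      ... | no c∉I with has-parent (All.head in-S) c∉I | extremal (All.head in-S) c∉I
      ...   | p , c↑p | q , q↑c , _ =
        ⊥-elim (p≢q (start-has-one-neighbour (acyclic (InS S)) uniq in-S walk
                      (listed p∈S) p≢c (inj₂ (trans (parent*-S c∈S) c↑p))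
                      (listed q∈S) q≢c (inj₁ (trans (parent*-S q∈S) q↑c))))
        where
        c∈S : c ∈ S
        c∈S = All.head in-S
        p∈S : p ∈ S
        p∈S = proj₂ (parent-∈S c↑p)
        q∈S : q ∈ S
        q∈S = proj₁ (parent-∈S q↑c)
        listed : ∀ {v} → v ∈ S → v ∈ˡ c ∷ _
        listed {v} = Equivalence.to (listing v)
        p≢c : p ≢ c
        p≢c refl = <-irrefl refl (rank-parent c↑p)
        q≢c : q ≢ c
        q≢c refl = <-irrefl refl (rank-parent q↑c)
        p≢q : p ≢ q
        p≢q refl = <-asym (rank-parent c↑p) (rank-parent q↑c)

      attachments-even : ∀ ps → IsPathListing S forest ps → ∀ w → w ∉ S → ∀ i → Edge w (lookup ps i) → 2 ∣ toℕ i
      attachments-even (_ ∷ rest) listing@((_ , _ , walk) , _) w w∉S i w–v =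
        proj₁ (parity-at rest walk i (pendant-neighbour-∈I w∉S w–v)) (path-start-∈I listing)

lemma3p8 : ∀ {n : ℕ} (G : Graph n) (α : ℕ) →
    Connected G → IsIndependenceNumber G α → 2 * α ≤ n →
    ∃[ t ] ∃[ S ] ∃[ T ]
      ( t + 1 ≤ 2 * α
      × ∣ S ∣ ≡ t
      × SpanningTreeOf T G
      × IsTreeOn (InS S) (Adj T)
      × (∀ (w : Fin n) → w ∉ S → degree T w ≡ 1 × (∃[ u ] (u ∈ S × Adj T w u)))
      × (t + 1 ≡ 2 * α →
          (¬ IsPathGraph S T → PendentInternalPathsEven S T)
          × (∀ (ps : List (Fin n)) → IsPathListing S T ps →
               ∀ (w : Fin n) → w ∉ S → ∀ i → Adj T w (lookup ps i) → 2 ∣ toℕ i)))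
lemma3p8 G α G-connected (_ , α-max) _ =
  ∣ S ∣ , S , forest , t+1≤2α , refl , spanning , core-tree , pendant ,
  λ t+1≡2α → (λ _ → paths-even (extremal t+1≡2α)) , attachments-even (extremal t+1≡2α)
  where
  open Growth G (proj₁ (proj₁ G-connected))
  open DominatingTree (grow G-connected)
  open ColouredTree tree
  open Completion (grow G-connected)
  t+1≡1+t : ∣ S ∣ + 1 ≡ suc ∣ S ∣
  t+1≡1+t = +-comm ∣ S ∣ 1
  2∣I∣≤2α : 2 * ∣ I ∣ ≤ 2 * α
  2∣I∣≤2α = *-monoʳ-≤ 2 (α-max I I-independent)
  t+1≤2α : ∣ S ∣ + 1 ≤ 2 * α
  t+1≤2α = ≤-trans (≤-reflexive t+1≡1+t) (≤-trans (proj₁ balanced) 2∣I∣≤2α)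
  extremal : ∣ S ∣ + 1 ≡ 2 * α → Extremal tree
  extremal t+1≡2α =
    proj₂ balanced (≤-antisym (proj₁ balanced) (≤-trans 2∣I∣≤2α (≤-reflexive (trans (sym t+1≡2α) t+1≡1+t))))
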